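{- Let $\mu$ be the morphism on $\{x,y\}^*$ given by $x\mapsto xy$, $y\mapsto xxy$, and $\gamma$ the morphism on $\{a,b,c\}^*$ given by $a\mapsto aca$, $b\mapsto cab$, $c\mapsto b$. Then (i) for all $w\in\{x,y\}^*$, $\mu(w)$ is primitive if and only if $w$ is primitive; (ii) for all $w\in\{ab,ac\}^*$, $\gamma(w)$ is primitive if and only if $w$ is primitive.
   Context: A word $w$ is primitive if $w=u^p$ for a word $u$ and integer $p$ implies $p=1$ and $u=w$. $\{ab,ac\}^*$ denotes the set of words that are concatenations of the blocks $ab$ and $ac$. -}

module Defs where

open import Data.Nat using (ℕ)
open import Data.List using (List; []; _∷_; concat; concatMap; replicate)
open import Data.Product using (Σ; _×_)
open import Relation.Binary.PropositionalEquality using (_≡_)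

_^ʷ_ : {A : Set} → List A → ℕ → List A
u ^ʷ p = concat (replicate p u)

Primitive : {A : Set} → List A → Set
Primitive {A} w = (u : List A) (p : ℕ) → w ≡ u ^ʷ p → (p ≡ 1) × (u ≡ w)

data XY : Set where
  x y : XY

data ABC : Set where
  a b c : ABC

μ₁ : XY → List XY
μ₁ x = x ∷ y ∷ []
μ₁ y = x ∷ x ∷ y ∷ []

μ : List XY → List XY
μ = concatMap μ₁

γ₁ : ABC → List ABC
γ₁ a = a ∷ c ∷ a ∷ []
γ₁ b = c ∷ a ∷ b ∷ []
γ₁ c = b ∷ []

γ : List ABC → List ABC
γ = concatMap γ₁

data Block : Set where
  AB AC : Block

blockWord : Block → List ABC
blockWord AB = a ∷ b ∷ []
blockWord AC = a ∷ c ∷ []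

In-ab-ac* : List ABC → Set
In-ab-ac* w = Σ (List Block) (λ bs → w ≡ concatMap blockWord bs)

-- γ acts on {ab,ac}* as μ does on {x,y}*, via the coding x ↦ ac, y ↦ ab, so (ii) reduces
-- to (i) together with the same statement for the coding. Both μ and the coding are
-- injective morphisms whose images end in a marker letter (y, resp. b or c) that occurs
-- nowhere else in them. If μ(w) = v^p with p ≥ 1, then v ends in the last letter of μ(w),
-- a marker, and a prefix of μ(w) ending in a marker is cut exactly between images of
-- letters, so v = μ(u); injectivity then gives w = u^p. The converse holds for every
-- morphism h, since h(u^p) = h(u)^p.
module Submission where

open import Defs
open import Data.Bool using (Bool; true; false)
open import Data.Empty using (⊥; ⊥-elim)
open import Data.List using (List; []; _∷_; _++_; concatMap; map)
open import Data.List.Properties using (++-assoc; ++-identityʳ; ++-cancelˡ; ++-conicalˡ; ∷-injective; concatMap-++)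
open import Data.Nat using (zero; suc)
open import Data.Product using (Σ; _×_; _,_)
open import Data.Sum using (_⊎_; inj₁; inj₂)
open import Function.Bundles using (_⇔_; mk⇔)
open import Function.Definitions using (Injective)
open import Function.Properties.Equivalence using (⇔-setoid)
open import Level using (0ℓ)
open import Relation.Binary.PropositionalEquality

^ʷ-sucʳ : ∀ {A : Set} (v : List A) k → v ^ʷ suc k ≡ v ^ʷ k ++ v
^ʷ-sucʳ v zero = ++-identityʳ v
^ʷ-sucʳ v (suc k) = trans (cong (v ++_) (^ʷ-sucʳ v k)) (sym (++-assoc v (v ^ʷ k) v))

¬Primitive-[] : ∀ {A : Set} → Primitive {A} [] → ⊥
¬Primitive-[] P with P [] 2 refl
... | () , _

module Morphism {A C : Set} (h₁ : A → List C) where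

  h : List A → List C
  h = concatMap h₁

  h-^ʷ : ∀ u p → h (u ^ʷ p) ≡ h u ^ʷ p
  h-^ʷ u zero = refl
  h-^ʷ u (suc p) = trans (concatMap-++ h₁ u (u ^ʷ p)) (cong (h u ++_) (h-^ʷ u p))

  primitive-of-primitive-image : ∀ w → Primitive (h w) → Primitive w
  primitive-of-primitive-image w P u p w≡uᵖ with P (h u) p (trans (cong h w≡uᵖ) (h-^ʷ u p))
  ... | refl , _ = refl , sym (trans w≡uᵖ (++-identityʳ u))

  primitive-image :
    (h-injective : ∀ w w′ → h w ≡ h w′ → w ≡ w′) →
    (h-root : ∀ w v k → h w ≡ v ^ʷ suc k → Σ (List A) λ u → v ≡ h u) →
    ∀ w → Primitive w → Primitive (h w)
  primitive-image h-injective h-root w P v zero hw≡[] =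
    ⊥-elim (¬Primitive-[] (subst Primitive (h-injective w [] hw≡[]) P))
  primitive-image h-injective h-root w P v (suc k) hw≡vᵖ with h-root w v k hw≡vᵖ
  ... | u , refl with P u (suc k) (h-injective w (u ^ʷ suc k) (trans hw≡vᵖ (sym (h-^ʷ u (suc k)))))
  ... | refl , refl = refl , refl

module MarkedWords {C : Set} (marker : C → Bool) where

  data Marked : List C → Set where
    here  : ∀ {z} → marker z ≡ true → Marked (z ∷ [])
    there : ∀ {z s} → marker z ≡ false → Marked s → Marked (z ∷ s)

  endsMarked : List C → Bool
  endsMarked [] = true
  endsMarked (z ∷ []) = marker z
  endsMarked (z ∷ z′ ∷ s) = endsMarked (z′ ∷ s)

  endsMarked-++-∷ : ∀ s z r → endsMarked (s ++ z ∷ r) ≡ endsMarked (z ∷ r)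
  endsMarked-++-∷ [] z r = refl
  endsMarked-++-∷ (z′ ∷ []) z r = refl
  endsMarked-++-∷ (z′ ∷ z″ ∷ s) z r = endsMarked-++-∷ (z″ ∷ s) z r

  endsMarked-++ : ∀ s v → endsMarked s ≡ true → endsMarked v ≡ true → endsMarked (s ++ v) ≡ true
  endsMarked-++ s [] es _ = trans (cong endsMarked (++-identityʳ s)) es
  endsMarked-++ s (z ∷ r) _ ev = trans (endsMarked-++-∷ s z r) ev

  endsMarked-suffix : ∀ s v → endsMarked (s ++ v) ≡ true → endsMarked v ≡ true
  endsMarked-suffix s [] _ = refl
  endsMarked-suffix s (z ∷ r) e = trans (sym (endsMarked-++-∷ s z r)) e

  Marked⇒endsMarked : ∀ {s} → Marked s → endsMarked s ≡ true
  Marked⇒endsMarked (here mz) = mz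
  Marked⇒endsMarked (there _ (here mz)) = mz
  Marked⇒endsMarked (there _ ms@(there _ _)) = Marked⇒endsMarked ms

  marked-and-unmarked : ∀ {z} → marker z ≡ true → marker z ≡ false → ⊥
  marked-and-unmarked mz ¬mz with trans (sym mz) ¬mz
  ... | ()

  Marked-++-nonempty : ∀ {s} X → Marked s → s ++ X ≡ [] → ⊥
  Marked-++-nonempty X (here _) ()
  Marked-++-nonempty X (there _ _) ()

  Marked-prefix-unique : ∀ {s s′ X Y} → Marked s → Marked s′ → s ++ X ≡ s′ ++ Y → s ≡ s′
  Marked-prefix-unique (here _) (here _) eq with ∷-injective eq
  ... | refl , _ = refl
  Marked-prefix-unique (here mz) (there ¬mz _) eq with ∷-injective eq
  ... | refl , _ = ⊥-elim (marked-and-unmarked mz ¬mz)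
  Marked-prefix-unique (there ¬mz _) (here mz) eq with ∷-injective eq
  ... | refl , _ = ⊥-elim (marked-and-unmarked mz ¬mz)
  Marked-prefix-unique (there _ ms) (there _ ms′) eq with ∷-injective eq
  ... | refl , eq′ = cong (_ ∷_) (Marked-prefix-unique ms ms′ eq′)

  Marked-cut : ∀ {s r} → Marked s → ∀ v t → v ++ t ≡ s ++ r → endsMarked v ≡ true →
               v ≡ [] ⊎ Σ (List C) λ v′ → v ≡ s ++ v′
  Marked-cut _ [] _ _ _ = inj₁ refl
  Marked-cut (here _) (z ∷ v) t eq _ with ∷-injective eq
  ... | refl , _ = inj₂ (v , refl)
  Marked-cut (there ¬mz _) (z ∷ []) t eq mz with ∷-injective eq
  ... | refl , _ = ⊥-elim (marked-and-unmarked mz ¬mz)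
  Marked-cut (there _ ms) (z ∷ z′ ∷ v) t eq e with ∷-injective eq
  ... | refl , eq′ with Marked-cut ms (z′ ∷ v) t eq′ e
  ...   | inj₂ (v′ , v≡sv′) = inj₂ (v′ , cong (z ∷_) v≡sv′)

open MarkedWords using (Marked; here; there)

module MarkedCode {A C : Set} (marker : C → Bool) (h₁ : A → List C)
  (h₁-marked : ∀ l → Marked marker (h₁ l))
  (h₁-injective : Injective _≡_ _≡_ h₁)
  where

  open MarkedWords marker hiding (Marked)
  open Morphism h₁

  h-injective : ∀ w w′ → h w ≡ h w′ → w ≡ w′
  h-injective [] [] _ = refl
  h-injective [] (l ∷ w′) eq = ⊥-elim (Marked-++-nonempty (h w′) (h₁-marked l) (sym eq))
  h-injective (l ∷ w) [] eq = ⊥-elim (Marked-++-nonempty (h w) (h₁-marked l) eq)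
  h-injective (l ∷ w) (l′ ∷ w′) eq
    with h₁-injective (Marked-prefix-unique (h₁-marked l) (h₁-marked l′) eq)
  ... | refl = cong (l ∷_) (h-injective w w′ (++-cancelˡ (h₁ l) (h w) (h w′) eq))

  endsMarked-h : ∀ w → endsMarked (h w) ≡ true
  endsMarked-h [] = refl
  endsMarked-h (l ∷ w) = endsMarked-++ (h₁ l) (h w) (Marked⇒endsMarked (h₁-marked l)) (endsMarked-h w)

  prefix-of-image : ∀ w v t → v ++ t ≡ h w → endsMarked v ≡ true → Σ (List A) λ u → v ≡ h u
  prefix-of-image [] v t eq _ = [] , ++-conicalˡ v t eq
  prefix-of-image (l ∷ w) v t eq e with Marked-cut (h₁-marked l) v t eq e
  ... | inj₁ refl = [] , refl
  ... | inj₂ (v′ , refl)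
    with prefix-of-image w v′ t (++-cancelˡ (h₁ l) (v′ ++ t) (h w) (trans (sym (++-assoc (h₁ l) v′ t)) eq))
                         (endsMarked-suffix (h₁ l) v′ e)
  ...   | u , refl = l ∷ u , refl

  h-root : ∀ w v k → h w ≡ v ^ʷ suc k → Σ (List A) λ u → v ≡ h u
  h-root w v k hw≡vᵖ = prefix-of-image w v (v ^ʷ k) (sym hw≡vᵖ) v-endsMarked
    where
    v-endsMarked : endsMarked v ≡ true
    v-endsMarked = endsMarked-suffix (v ^ʷ k) v
      (subst (λ s → endsMarked s ≡ true) (trans hw≡vᵖ (^ʷ-sucʳ v k)) (endsMarked-h w))

  primitive-image⇔primitive : ∀ w → Primitive (h w) ⇔ Primitive w
  primitive-image⇔primitive w =
    mk⇔ (primitive-of-primitive-image w) (primitive-image h-injective h-root w)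

isY : XY → Bool
isY x = false
isY y = true

μ₁-marked : ∀ l → Marked isY (μ₁ l)
μ₁-marked x = there refl (here refl)
μ₁-marked y = there refl (there refl (here refl))

μ₁-injective : Injective _≡_ _≡_ μ₁
μ₁-injective {x} {x} _ = refl
μ₁-injective {x} {y} ()
μ₁-injective {y} {x} ()
μ₁-injective {y} {y} _ = refl

μ-primitive⇔primitive : ∀ w → Primitive (μ w) ⇔ Primitive w
μ-primitive⇔primitive = MarkedCode.primitive-image⇔primitive isY μ₁ μ₁-marked μ₁-injective

blockCode₁ : XY → List ABC
blockCode₁ x = a ∷ c ∷ []
blockCode₁ y = a ∷ b ∷ []

blockCode : List XY → List ABC
blockCode = concatMap blockCode₁

isBC : ABC → Bool
isBC a = false
isBC b = true
isBC c = true

blockCode₁-marked : ∀ l → Marked isBC (blockCode₁ l)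
blockCode₁-marked x = there refl (here refl)
blockCode₁-marked y = there refl (here refl)

blockCode₁-injective : Injective _≡_ _≡_ blockCode₁
blockCode₁-injective {x} {x} _ = refl
blockCode₁-injective {x} {y} ()
blockCode₁-injective {y} {x} ()
blockCode₁-injective {y} {y} _ = refl

blockCode-primitive⇔primitive : ∀ w → Primitive (blockCode w) ⇔ Primitive w
blockCode-primitive⇔primitive =
  MarkedCode.primitive-image⇔primitive isBC blockCode₁ blockCode₁-marked blockCode₁-injective

γ∘blockCode : ∀ w → γ (blockCode w) ≡ blockCode (μ w)
γ∘blockCode [] = refl
γ∘blockCode (x ∷ w) = cong (λ s → a ∷ c ∷ a ∷ b ∷ s) (γ∘blockCode w)
γ∘blockCode (y ∷ w) = cong (λ s → a ∷ c ∷ a ∷ c ∷ a ∷ b ∷ s) (γ∘blockCode w)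

blockToXY : Block → XY
blockToXY AB = y
blockToXY AC = x

concatMap-blockWord≡blockCode : ∀ bs → concatMap blockWord bs ≡ blockCode (map blockToXY bs)
concatMap-blockWord≡blockCode [] = refl
concatMap-blockWord≡blockCode (AB ∷ bs) = cong (λ s → a ∷ b ∷ s) (concatMap-blockWord≡blockCode bs)
concatMap-blockWord≡blockCode (AC ∷ bs) = cong (λ s → a ∷ c ∷ s) (concatMap-blockWord≡blockCode bs)

γ-blockCode-primitive⇔primitive : ∀ w → Primitive (γ (blockCode w)) ⇔ Primitive (blockCode w)
γ-blockCode-primitive⇔primitive w = begin
  Primitive (γ (blockCode w)) ≡⟨ cong Primitive (γ∘blockCode w) ⟩
  Primitive (blockCode (μ w)) ≈⟨ blockCode-primitive⇔primitive (μ w) ⟩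
  Primitive (μ w)             ≈⟨ μ-primitive⇔primitive w ⟩
  Primitive w                 ≈⟨ blockCode-primitive⇔primitive w ⟨
  Primitive (blockCode w)     ∎
  where open import Relation.Binary.Reasoning.Setoid (⇔-setoid 0ℓ)

mainTheorem10 : ((w : List XY) → Primitive (μ w) ⇔ Primitive w)
    × ((w : List ABC) → In-ab-ac* w → Primitive (γ w) ⇔ Primitive w)
mainTheorem10 = μ-primitive⇔primitive , γ-primitive⇔primitive
  where
  γ-primitive⇔primitive : (w : List ABC) → In-ab-ac* w → Primitive (γ w) ⇔ Primitive w
  γ-primitive⇔primitive _ (bs , refl) rewrite concatMap-blockWord≡blockCode bs =
    γ-blockCode-primitive⇔primitive (map blockToXY bs)
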